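{- Let $G$ be a graph that does not contain the cycle $C_4$ as a (not necessarily induced) subgraph. Then $\overset{\rightarrow}{\gamma}_{LD}(G)=\gamma_{LD}(G)$.
   Context: All graphs are finite and simple. For an undirected graph $G=(V,E)$, $S\subseteq V$ is a locating-dominating set if every $u\notin S$ has $N(u)\cap S\neq\emptyset$ and distinct $u,v\notin S$ satisfy $N(u)\cap S\neq N(v)\cap S$; $\gamma_{LD}(G)$ is the minimum size of such a set. For an orientation $D$ of $G$ (each edge given exactly one direction), $S$ is locating-dominating in $D$ if the same holds with $N(\cdot)$ replaced by the in-neighbourhood $N^-_D(\cdot)$; $\gamma_{LD}(D)$ is the minimum size. $\overset{\rightarrow}{\gamma}_{LD}(G)=\min_D\gamma_{LD}(D)$ over all orientations $D$ of $G$. -}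

module Defs where

open import Data.Nat using (ℕ; _≤_)
open import Data.Bool using (Bool; true; false)
open import Data.Fin using (Fin)
open import Data.Fin.Subset using (Subset; _∈_; _∉_; ∣_∣)
open import Data.Product using (Σ; ∃; ∃-syntax; _×_; _,_)
open import Data.Sum using (_⊎_)
open import Relation.Nullary using (¬_)
open import Relation.Binary.PropositionalEquality using (_≡_; _≢_)

record Graph (n : ℕ) : Set where
  field
    adj     : Fin n → Fin n → Bool
    adj-sym : ∀ u v → adj u v ≡ adj v u
    irrefl  : ∀ u → adj u u ≡ false
open Graph public

-- An orientation of G: arc u v = true means the edge uv is directed u → v.
-- Every arc comes from an edge, and every edge gets exactly one direction.
record Orientation {n : ℕ} (G : Graph n) : Set where
  field
    arc        : Fin n → Fin n → Bool
    arc⇒edge   : ∀ u v → arc u v ≡ true → adj G u v ≡ true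
    edge⇒arc   : ∀ u v → adj G u v ≡ true → (arc u v ≡ true) ⊎ (arc v u ≡ true)
    antisym    : ∀ u v → arc u v ≡ true → arc v u ≡ false
open Orientation public

-- Locating-dominating set with respect to a "neighbour" relation
-- R w u = true meaning "w ∈ N(u)" (the neighbourhood in a graph,
-- or the in-neighbourhood in a digraph).
record IsLocDom {n : ℕ} (R : Fin n → Fin n → Bool) (S : Subset n) : Set where
  field
    dominating : ∀ u → u ∉ S → ∃[ w ] (w ∈ S × R w u ≡ true)
    locating   : ∀ u v → u ∉ S → v ∉ S → u ≢ v →
                 ∃[ w ] (w ∈ S × R w u ≢ R w v)

LocDomG : ∀ {n} → Graph n → Subset n → Set
LocDomG G S = IsLocDom (adj G) S

LocDomD : ∀ {n} {G : Graph n} → Orientation G → Subset n → Set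
LocDomD D S = IsLocDom (arc D) S

γLD≡ : ∀ {n} → Graph n → ℕ → Set
γLD≡ {n} G k =
  (∃[ S ] (LocDomG G S × ∣ S ∣ ≡ k)) ×
  (∀ (S : Subset n) → LocDomG G S → k ≤ ∣ S ∣)

γ⃗LD≡ : ∀ {n} → Graph n → ℕ → Set
γ⃗LD≡ {n} G k =
  (∃[ D ] ∃[ S ] (LocDomD {G = G} D S × ∣ S ∣ ≡ k)) ×
  (∀ (D : Orientation G) (S : Subset n) → LocDomD D S → k ≤ ∣ S ∣)

HasC4 : ∀ {n} → Graph n → Set
HasC4 {n} G =
  Σ (Fin n) λ a → Σ (Fin n) λ b → Σ (Fin n) λ c → Σ (Fin n) λ d →
    (a ≢ b) × (a ≢ c) × (a ≢ d) × (b ≢ c) × (b ≢ d) × (c ≢ d) ×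
    (adj G a b ≡ true) × (adj G b c ≡ true) ×
    (adj G c d ≡ true) × (adj G d a ≡ true)

{-# OPTIONS --safe #-}
-- Whether S is locating-dominating only depends on the edges between S and its
-- complement. Orienting all of them out of S therefore keeps every
-- locating-dominating set of G locating-dominating, so γ⃗_LD ≤ γ_LD for every
-- graph. Conversely, an in-neighbourhood separation by w₀ ∈ S that G does not
-- see means w₀ is adjacent to both u and v with, say, w₀ → u only; the
-- in-neighbour of v in S then separates u and v in G, or closes a C₄.
module Submission where

open import Defs
open import Data.Nat using (ℕ; _<ᵇ_)
open import Data.Nat.Properties using (<ᵇ⇒<; <⇒<ᵇ; <-asym; <-cmp)
open import Data.Bool using (Bool; true; false; _∧_; _≟_)
open import Data.Bool.Properties using (T-≡; ∧-identityʳ)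
open import Data.Fin using (Fin; toℕ)
open import Data.Fin.Properties using (toℕ-injective)
open import Data.Fin.Subset using (Subset; _∈_; _∉_)
open import Data.Vec using (lookup)
open import Data.Vec.Properties using (lookup⇒[]=; []=⇒lookup)
open import Data.Product using (_×_; _,_; ∃-syntax)
open import Data.Sum using (_⊎_; inj₁; inj₂)
import Data.Sum as Sum
open import Data.Empty using (⊥-elim)
open import Function using (Equivalence; _∘_)
open import Relation.Binary.Definitions using (tri<; tri≈; tri>)
open import Relation.Nullary using (¬_; yes; no)
open import Relation.Binary.PropositionalEquality

private
  variable
    n : ℕ

Asym : {A : Set} → (A → A → Bool) → Set
Asym _≺_ = ∀ u v → u ≺ v ≡ true → v ≺ u ≡ false

Connex : {A : Set} → (A → A → Bool) → Set
Connex _≺_ = ∀ u v → u ≢ v → u ≺ v ≡ true ⊎ v ≺ u ≡ true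

<ᵇ-asym : Asym _<ᵇ_
<ᵇ-asym m k m<k with k <ᵇ m in k<m
... | false = refl
... | true  = ⊥-elim (<-asym (<ᵇ⇒< m k (Equivalence.from T-≡ m<k))
                             (<ᵇ⇒< k m (Equivalence.from T-≡ k<m)))

<ᵇ-connex : Connex _<ᵇ_
<ᵇ-connex m k m≢k with <-cmp m k
... | tri< m<k _ _ = inj₁ (Equivalence.to T-≡ (<⇒<ᵇ m<k))
... | tri≈ _ m≡k _ = ⊥-elim (m≢k m≡k)
... | tri> _ _ k<m = inj₂ (Equivalence.to T-≡ (<⇒<ᵇ k<m))

_<ᶠ_ : Fin n → Fin n → Bool
u <ᶠ v = toℕ u <ᵇ toℕ v

<ᶠ-asym : Asym (_<ᶠ_ {n})
<ᶠ-asym u v = <ᵇ-asym (toℕ u) (toℕ v)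

<ᶠ-connex : Connex (_<ᶠ_ {n})
<ᶠ-connex u v u≢v = <ᵇ-connex (toℕ u) (toℕ v) (u≢v ∘ toℕ-injective)

firstBy : {A : Set} → (A → Bool) → (A → A → Bool) → A → A → Bool
firstBy p _≺_ u v with p u | p v
... | true  | false = true
... | false | true  = false
... | _     | _     = u ≺ v

firstBy-asym : {A : Set} (p : A → Bool) {_≺_ : A → A → Bool} →
               Asym _≺_ → Asym (firstBy p _≺_)
firstBy-asym p {_≺_} asym u v u≺v with p u | p v
... | true  | true  = asym u v u≺v
... | true  | false = refl
... | false | false = asym u v u≺v

firstBy-connex : {A : Set} (p : A → Bool) {_≺_ : A → A → Bool} →
                 Connex _≺_ → Connex (firstBy p _≺_)
firstBy-connex p connex u v u≢v with p u | p v
... | true  | true  = connex u v u≢v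
... | true  | false = inj₁ refl
... | false | true  = inj₂ refl
... | false | false = connex u v u≢v

∉⇒lookup≡false : ∀ {S : Subset n} {u} → u ∉ S → lookup S u ≡ false
∉⇒lookup≡false {S = S} {u} u∉S with lookup S u in eq
... | false = refl
... | true  = ⊥-elim (u∉S (lookup⇒[]= u S eq))

module _ (G : Graph n) where

  orientBy : (_≺_ : Fin n → Fin n → Bool) → Asym _≺_ → Connex _≺_ → Orientation G
  orientBy _≺_ asym connex = record
    { arc      = λ u v → adj G u v ∧ u ≺ v
    ; arc⇒edge = λ u v → ∧-true₁
    ; edge⇒arc = λ u v uv →
        Sum.map (∧-intro uv) (∧-intro (trans (adj-sym G v u) uv))
                (connex u v (adjacent⇒≢ uv))
    ; antisym  = λ u v u→v → ∧-false₂ (adj G v u) (asym u v (∧-true₂ u→v))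
    }
    where
    ∧-true₁ : ∀ {a b} → a ∧ b ≡ true → a ≡ true
    ∧-true₁ {true} _ = refl

    ∧-true₂ : ∀ {a b} → a ∧ b ≡ true → b ≡ true
    ∧-true₂ {true} b≡true = b≡true

    ∧-intro : ∀ {a b} → a ≡ true → b ≡ true → a ∧ b ≡ true
    ∧-intro refl refl = refl

    ∧-false₂ : ∀ a {b} → b ≡ false → a ∧ b ≡ false
    ∧-false₂ true  refl = refl
    ∧-false₂ false refl = refl

    adjacent⇒≢ : ∀ {u v} → adj G u v ≡ true → u ≢ v
    adjacent⇒≢ {u} uv refl with () ← trans (sym (irrefl G u)) uv

  outwardFrom : Subset n → Orientation G
  outwardFrom S = orientBy (firstBy (lookup S) _<ᶠ_)
                           (firstBy-asym (lookup S) <ᶠ-asym)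
                           (firstBy-connex (lookup S) <ᶠ-connex)

  outwardFrom-arc : ∀ S {w u} → w ∈ S → u ∉ S → arc (outwardFrom S) w u ≡ adj G w u
  outwardFrom-arc S {w} {u} w∈S u∉S
    rewrite []=⇒lookup w∈S | ∉⇒lookup≡false u∉S = ∧-identityʳ (adj G w u)

IsLocDom-cong : {R R′ : Fin n → Fin n → Bool} {S : Subset n} →
                (∀ {w u} → w ∈ S → u ∉ S → R w u ≡ R′ w u) →
                IsLocDom R S → IsLocDom R′ S
IsLocDom-cong R≡R′ ld = record
  { dominating = λ u u∉S → let w , w∈S , wu = IsLocDom.dominating ld u u∉S
                           in w , w∈S , trans (sym (R≡R′ w∈S u∉S)) wu
  ; locating   = λ u v u∉S v∉S u≢v →
      let w , w∈S , wu≢wv = IsLocDom.locating ld u v u∉S v∉S u≢v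
      in w , w∈S , λ eq → wu≢wv (trans (R≡R′ w∈S u∉S) (trans eq (sym (R≡R′ w∈S v∉S))))
  }

LocDomG⇒LocDomD-outwardFrom : (G : Graph n) {S : Subset n} →
                              LocDomG G S → LocDomD (outwardFrom G S) S
LocDomG⇒LocDomD-outwardFrom G {S} = IsLocDom-cong (λ w∈S u∉S → sym (outwardFrom-arc G S w∈S u∉S))

∈∧∉⇒≢ : {S : Subset n} {w u : Fin n} → w ∈ S → u ∉ S → w ≢ u
∈∧∉⇒≢ {S = S} w∈S u∉S refl = u∉S w∈S

module _ {G : Graph n} (noC4 : ¬ HasC4 G) (D : Orientation G) {S : Subset n}
         (ld : LocDomD D S) where

  -- The in-neighbour w₁ ∈ S of y differs from w₀, so x w₀ y w₁ would be a C₄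
  -- if w₁ were adjacent to x.
  separator-of-non-arc : ∀ {x y w₀} → x ∉ S → y ∉ S → x ≢ y → w₀ ∈ S →
                         adj G w₀ x ≡ true → adj G w₀ y ≡ true → arc D w₀ y ≡ false →
                         ∃[ w ] (w ∈ S × adj G w x ≢ adj G w y)
  separator-of-non-arc {x} {y} {w₀} x∉S y∉S x≢y w₀∈S w₀x w₀y w₀↛y
    with IsLocDom.dominating ld y y∉S
  ... | w₁ , w₁∈S , w₁→y with adj G w₁ x in w₁x
  ...   | false = w₁ , w₁∈S , λ eq → false≢true (trans (sym w₁x) (trans eq (arc⇒edge D w₁ y w₁→y)))
    where false≢true : false ≢ true
          false≢true ()
  ...   | true  = ⊥-elim (noC4 (x , w₀ , y , w₁ ,
                    ≢-sym (∈∧∉⇒≢ w₀∈S x∉S) , x≢y , ≢-sym (∈∧∉⇒≢ w₁∈S x∉S) ,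
                    ∈∧∉⇒≢ w₀∈S y∉S , w₀≢w₁ , ≢-sym (∈∧∉⇒≢ w₁∈S y∉S) ,
                    trans (adj-sym G x w₀) w₀x , w₀y ,
                    trans (adj-sym G y w₁) (arc⇒edge D w₁ y w₁→y) , w₁x))
    where w₀≢w₁ : w₀ ≢ w₁
          w₀≢w₁ refl with () ← trans (sym w₀↛y) w₁→y

  LocDomD⇒LocDomG : LocDomG G S
  LocDomD⇒LocDomG = record
    { dominating = λ u u∉S → let w , w∈S , w→u = IsLocDom.dominating ld u u∉S
                             in w , w∈S , arc⇒edge D w u w→u
    ; locating   = locating
    }
    where
    locating : ∀ u v → u ∉ S → v ∉ S → u ≢ v → ∃[ w ] (w ∈ S × adj G w u ≢ adj G w v)
    locating u v u∉S v∉S u≢v with IsLocDom.locating ld u v u∉S v∉S u≢v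
    ... | w₀ , w₀∈S , w₀u≢w₀v with adj G w₀ u ≟ adj G w₀ v
    ...   | no  w₀u≢w₀v′ = w₀ , w₀∈S , w₀u≢w₀v′
    ...   | yes w₀u≡w₀v with arc D w₀ u in w₀→u | arc D w₀ v in w₀→v
    ...     | true  | true  = ⊥-elim (w₀u≢w₀v refl)
    ...     | false | false = ⊥-elim (w₀u≢w₀v refl)
    ...     | true  | false =
                let w₀u = arc⇒edge D w₀ u w₀→u
                in separator-of-non-arc u∉S v∉S u≢v w₀∈S w₀u (trans (sym w₀u≡w₀v) w₀u) w₀→v
    ...     | false | true  =
                let w₀v = arc⇒edge D w₀ v w₀→v
                    w , w∈S , wv≢wu = separator-of-non-arc v∉S u∉S (≢-sym u≢v) w₀∈S
                                        w₀v (trans w₀u≡w₀v w₀v) w₀→u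
                in w , w∈S , ≢-sym wv≢wu

theorem10 : ∀ {n : ℕ} (G : Graph n) → ¬ HasC4 G →
    ∀ (k : ℕ) → (γLD≡ G k → γ⃗LD≡ G k) × (γ⃗LD≡ G k → γLD≡ G k)
theorem10 G noC4 k = undirected⇒oriented , oriented⇒undirected
  where
  undirected⇒oriented : γLD≡ G k → γ⃗LD≡ G k
  undirected⇒oriented ((S , ld , ∣S∣≡k) , minimal) =
    (outwardFrom G S , S , LocDomG⇒LocDomD-outwardFrom G ld , ∣S∣≡k) ,
    λ D S′ ld′ → minimal S′ (LocDomD⇒LocDomG noC4 D ld′)

  oriented⇒undirected : γ⃗LD≡ G k → γLD≡ G k
  oriented⇒undirected ((D , S , ld , ∣S∣≡k) , minimal) =
    (S , LocDomD⇒LocDomG noC4 D ld , ∣S∣≡k) ,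
    λ S′ ld′ → minimal (outwardFrom G S′) S′ (LocDomG⇒LocDomD-outwardFrom G ld′)
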